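{- Let $n$ be a positive integer, let $X = \{ (\lambda_1, \lambda_2, \lambda_3) \vdash n \mid \lambda_1 \equiv \lambda_2 \equiv \lambda_3 \pmod{2} \}$ and let $Y = \{ (k,k,1^{n-2k}) \mid 1 \leq k \leq \lfloor n/2 \rfloor \}$. Then $$\sum_{\lambda \in X} f^\lambda = \sum_{\mu \in Y} f^\mu.$$
   Context: $(\lambda_1,\lambda_2,\lambda_3)\vdash n$ denotes a partition of $n$ with at most three parts, written with exactly three entries $\lambda_1\ge\lambda_2\ge\lambda_3\ge 0$ (zero parts allowed, so e.g. $\lambda_3=0$ is possible). $(k,k,1^{m})$ is the partition with two parts equal to $k$ followed by $m$ parts equal to $1$. For a partition $\mu$, $f^\mu$ is the number of standard Young tableaux of shape $\mu$ (the degree of the irreducible character $\chi^\mu$ of the symmetric group). -}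

module Defs where

open import Data.Nat using (ℕ; zero; suc; _+_; _∸_; _≡ᵇ_; _≤ᵇ_; _<ᵇ_; _/_; _%_)
open import Data.Bool using (Bool; true; false; _∧_; if_then_else_)
open import Data.Nat.ListAction using (sum)
open import Data.List using (List; []; _∷_; length; map; filter; concatMap; replicate; upTo; applyUpTo)
open import Data.Bool.Properties using (T?)

-- Partitions are lists of natural numbers (rows λ₁ ≥ λ₂ ≥ …).
-- Zero entries are allowed (e.g. (λ₁,λ₂,0)); a row of length 0 simply
-- contains no boxes.

decreasing : List ℕ → Bool
decreasing []           = true
decreasing (x ∷ [])     = true
decreasing (x ∷ y ∷ xs) = (y ≤ᵇ x) ∧ decreasing (y ∷ xs)

eqList : List ℕ → List ℕ → Bool
eqList []       []       = true
eqList (x ∷ xs) (y ∷ ys) = (x ≡ᵇ y) ∧ eqList xs ys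
eqList _        _        = false

-- A standard Young tableau T of shape μ ⊢ n is encoded by its row word
-- w = (w₁,…,wₙ), where wᵢ is the row (0-based) containing the entry i.
-- Entries increase along rows automatically (they are placed left to
-- right in increasing order); columns increase iff, for every j, the
-- entries 1..j occupy a partition shape, i.e. the content of every prefix
-- of w is weakly decreasing.

count : ℕ → List ℕ → ℕ
count r []       = 0
count r (x ∷ xs) = (if x ≡ᵇ r then 1 else 0) + count r xs

content : ℕ → List ℕ → List ℕ
content ℓ w = applyUpTo (λ r → count r w) ℓ

prefixes : List ℕ → List (List ℕ)
prefixes []       = [] ∷ []
prefixes (x ∷ xs) = [] ∷ map (x ∷_) (prefixes xs)

allB : List Bool → Bool
allB []       = true
allB (b ∷ bs) = b ∧ allB bs

words : ℕ → ℕ → List (List ℕ)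
words zero    ℓ = [] ∷ []
words (suc m) ℓ = concatMap (λ r → map (r ∷_) (words m ℓ)) (upTo ℓ)

isSYTWord : List ℕ → List ℕ → Bool
isSYTWord μ w =
  eqList (content (length μ) w) μ
  ∧ allB (map (λ p → decreasing (content (length μ) p)) (prefixes w))

f : List ℕ → ℕ
f μ = length (filter (λ w → T? (isSYTWord μ w)) (words (sum μ) (length μ)))

parity : ℕ → ℕ
parity a = a % 2

inX : ℕ → ℕ → ℕ → ℕ → Bool
inX n a b c =
  ((a + b + c) ≡ᵇ n) ∧ (b ≤ᵇ a) ∧ (c ≤ᵇ b)
  ∧ (parity a ≡ᵇ parity b) ∧ (parity b ≡ᵇ parity c)

-- Σ_{λ ∈ X} f^λ ; every such triple has a , b ≤ n and c = n ∸ (a + b)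
sumX : ℕ → ℕ
sumX n = sum (concatMap (λ a → map (λ b →
           if inX n a b (n ∸ (a + b))
           then f (a ∷ b ∷ (n ∸ (a + b)) ∷ [])
           else 0) (upTo (suc n))) (upTo (suc n)))

hook2 : ℕ → ℕ → List ℕ
hook2 n k = k ∷ k ∷ replicate (n ∸ (k + k)) 1

sumY : ℕ → ℕ
sumY n = sum (map (λ i → f (hook2 n (suc i))) (upTo (n / 2)))

{-# OPTIONS --safe #-}
-- Both sides count lattice walks. A standard tableau with at most three rows is a walk in the
-- chamber λ₁ ≥ λ₂ ≥ λ₃, so the left side E(n) counts the chamber walks of length n from the origin
-- that end with all three rows of the same parity. From any chamber point exactly one of "stop" and
-- the legal one-box moves reaches such a point, hence E(n + 1) + E(n) counts all chamber walks of
-- length n. In the coordinates (λ₁ - λ₂, λ₂ - λ₃) these are quadrant walks, and those from (x, y)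
-- number the sum over i ≤ x, j ≤ y of the Motzkin paths from height i + j down to 0; from the
-- origin this is the Motzkin number M(n). On the right, a tableau of shape (k, k, 1^t) is a path of
-- height λ₁ - λ₂ whose steps are the boxes in row one (up), row two (down) and the leg (flat, only
-- once row two is non-empty). Summing over k gives the Motzkin paths with no flat step before the
-- first down step, and their numbers R(n) also satisfy R(n + 1) + R(n) = M(n) for n ≥ 1. As
-- E(1) = R(1) = 0, the two sequences agree from n = 1 on.
module Submission where

open import Algebra.Properties.CommutativeSemigroup using (interchange)
open import Data.Bool using (Bool; true; false; _∧_; if_then_else_; T)
open import Data.Bool.Properties using (T?; T-≡; if-eta; ∧-assoc; ∧-comm; ∧-zeroʳ; ∧-identityʳ)
open import Data.Empty using (⊥-elim)
open import Data.List using (List; []; _∷_; length; filter; map; concatMap; applyUpTo; upTo; replicate)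
open import Data.List.Properties using (map-∘; map-cong; map-upTo; map-concatMap; length-replicate)
open import Data.Nat using (ℕ; zero; suc; _+_; _*_; _∸_; _/_; _≤_; _<_; z≤n; s≤s; z<s; s<s; _≡ᵇ_; _<ᵇ_; _≤ᵇ_)
open import Data.Nat.DivMod using (m*n/n≡m; /-monoˡ-≤; m/n*n≤m)
open import Data.Nat.ListAction using (sum)
open import Data.Nat.ListAction.Properties using (sum-++)
open import Data.Nat.Properties
open import Data.Nat.Tactic.RingSolver using (solve-∀)
open import Data.Product using (_×_; _,_)
open import Data.Sum using (_⊎_; inj₁; inj₂)
open import Defs
open import Function using (_∘_; Equivalence)
open import Relation.Binary.Definitions using (tri<; tri≈; tri>)
open import Relation.Binary.PropositionalEquality
open import Relation.Nullary.Decidable.Core using (proof)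
open import Relation.Nullary.Reflects using (ofʸ; ofⁿ)

+-interchange : ∀ a b c d → (a + b) + (c + d) ≡ (a + c) + (b + d)
+-interchange = interchange +-commutativeSemigroup

𝟙 : Bool → ℕ
𝟙 b = if b then 1 else 0

𝟙-∧ : ∀ b c → 𝟙 (b ∧ c) ≡ (if b then 𝟙 c else 0)
𝟙-∧ true  c = refl
𝟙-∧ false c = refl

if-𝟙 : ∀ b c → (if b then 𝟙 c else 0) ≡ 𝟙 (c ∧ b)
if-𝟙 b c = trans (sym (𝟙-∧ b c)) (cong 𝟙 (∧-comm b c))

if-+ : ∀ b (x y : ℕ) → (if b then x else 0) + (if b then y else 0) ≡ (if b then x + y else 0)
if-+ true  x y = refl
if-+ false x y = refl

if-0 : ∀ b {x : ℕ} → x ≡ 0 → (if b then x else 0) ≡ 0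
if-0 b refl = if-eta b

T⇒≡true : ∀ {b} → T b → b ≡ true
T⇒≡true = Equivalence.to T-≡

≡true⇒T : ∀ {b} → b ≡ true → T b
≡true⇒T = Equivalence.from T-≡

∧-trueˡ : ∀ {x y} → x ∧ y ≡ true → x ≡ true
∧-trueˡ {true} _ = refl

∧-trueʳ : ∀ {x y} → x ∧ y ≡ true → y ≡ true
∧-trueʳ {true} e = e

≡ᵇ-refl : ∀ n → (n ≡ᵇ n) ≡ true
≡ᵇ-refl zero    = refl
≡ᵇ-refl (suc n) = ≡ᵇ-refl n

≢⇒≡ᵇ-false : ∀ {m n} → m ≢ n → (m ≡ᵇ n) ≡ false
≢⇒≡ᵇ-false {m} {n} m≢n with m ≡ᵇ n | proof (m ≟ n)
... | true  | ofʸ m≡n = ⊥-elim (m≢n m≡n)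
... | false | _       = refl

+-≡ᵇ-cancelʳ : ∀ m n → (m + n ≡ᵇ n) ≡ (m ≡ᵇ 0)
+-≡ᵇ-cancelʳ m zero    = cong (_≡ᵇ 0) (+-identityʳ m)
+-≡ᵇ-cancelʳ m (suc n) = trans (cong (_≡ᵇ suc n) (+-suc m n)) (+-≡ᵇ-cancelʳ m n)

≤⇒<ᵇ-false : ∀ {m n} → n ≤ m → (m <ᵇ n) ≡ false
≤⇒<ᵇ-false {m} {n} n≤m with m <ᵇ n | <ᵇ-reflects-< m n
... | true  | ofʸ m<n = ⊥-elim (<⇒≱ m<n n≤m)
... | false | _       = refl

sum-map-if : ∀ {A : Set} b (F : A → ℕ) xs →
             sum (map (λ x → if b then F x else 0) xs) ≡ (if b then sum (map F xs) else 0)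
sum-map-if true  F xs       = refl
sum-map-if false F []       = refl
sum-map-if false F (x ∷ xs) = sum-map-if false F xs

sum-concatMap : ∀ {A : Set} (G : A → List ℕ) xs → sum (concatMap G xs) ≡ sum (map (sum ∘ G) xs)
sum-concatMap G []       = refl
sum-concatMap G (x ∷ xs) = trans (sum-++ (G x) (concatMap G xs)) (cong (sum (G x) +_) (sum-concatMap G xs))

sum-map-concatMap : ∀ {A B : Set} (F : B → ℕ) (G : A → List B) xs →
                    sum (map F (concatMap G xs)) ≡ sum (map (λ x → sum (map F (G x))) xs)
sum-map-concatMap F G xs = trans (cong sum (map-concatMap F G xs)) (sum-concatMap (map F ∘ G) xs)

sum-replicate-1 : ∀ t → sum (replicate t 1) ≡ t
sum-replicate-1 zero    = refl
sum-replicate-1 (suc t) = cong suc (sum-replicate-1 t)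

∑< : ℕ → (ℕ → ℕ) → ℕ
∑< N F = sum (applyUpTo F N)

syntax ∑< N (λ i → e) = ∑[ i < N ] e

sum-map-upTo : ∀ (F : ℕ → ℕ) N → sum (map F (upTo N)) ≡ ∑[ i < N ] F i
sum-map-upTo F N = cong sum (map-upTo F N)

∑-cong : ∀ N {F G : ℕ → ℕ} → (∀ i → i < N → F i ≡ G i) → ∑[ i < N ] F i ≡ ∑[ i < N ] G i
∑-cong zero    e = refl
∑-cong (suc N) e = cong₂ _+_ (e 0 z<s) (∑-cong N (λ i i<N → e (suc i) (s<s i<N)))

∑-zero : ∀ N {F : ℕ → ℕ} → (∀ i → i < N → F i ≡ 0) → ∑[ i < N ] F i ≡ 0
∑-zero zero    e = refl
∑-zero (suc N) e = cong₂ _+_ (e 0 z<s) (∑-zero N (λ i i<N → e (suc i) (s<s i<N)))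

∑-select : ∀ N {F : ℕ → ℕ} x → x < N → (∀ i → i < N → i ≢ x → F i ≡ 0) → ∑[ i < N ] F i ≡ F x
∑-select (suc N) zero    _         e =
  trans (cong (_ +_) (∑-zero N (λ i i<N → e (suc i) (s<s i<N) λ ()))) (+-identityʳ _)
∑-select (suc N) (suc x) (s<s x<N) e =
  cong₂ _+_ (e 0 z<s λ ()) (∑-select N x x<N (λ i i<N i≢x → e (suc i) (s<s i<N) (i≢x ∘ suc-injective)))

∑-+ : ∀ N (F G : ℕ → ℕ) → ∑[ i < N ] (F i + G i) ≡ ∑[ i < N ] F i + ∑[ i < N ] G i
∑-+ zero    F G = refl
∑-+ (suc N) F G = trans (cong (F 0 + G 0 +_) (∑-+ N (F ∘ suc) (G ∘ suc))) (+-interchange (F 0) (G 0) _ _)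

∑-if : ∀ N b (F : ℕ → ℕ) → ∑[ i < N ] (if b then F i else 0) ≡ (if b then ∑[ i < N ] F i else 0)
∑-if N true  F = refl
∑-if N false F = ∑-zero N (λ _ _ → refl)

applyUpTo-cong : ∀ {A : Set} {F G : ℕ → A} → F ≗ G → ∀ N → applyUpTo F N ≡ applyUpTo G N
applyUpTo-cong e zero    = refl
applyUpTo-cong e (suc N) = cong₂ _∷_ (e 0) (applyUpTo-cong (e ∘ suc) N)

decreasing-entry : ∀ (h : ℕ → ℕ) N → decreasing (applyUpTo h N) ≡ true → ∀ s → suc s < N → h (suc s) ≤ h s
decreasing-entry h (suc zero)    d zero    (s<s ())
decreasing-entry h (suc (suc N)) d zero    _         = ≤ᵇ⇒≤ (h 1) (h 0) (≡true⇒T (∧-trueˡ d))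
decreasing-entry h (suc (suc N)) d (suc s) (s<s s<N) = decreasing-entry (h ∘ suc) (suc N) (∧-trueʳ d) s s<N

replicate-entry : ∀ (h : ℕ → ℕ) t → eqList (applyUpTo h t) (replicate t 1) ≡ true → ∀ s → s < t → h s ≡ 1
replicate-entry h (suc t) e zero    _         = ≡ᵇ⇒≡ (h 0) 1 (≡true⇒T (∧-trueˡ e))
replicate-entry h (suc t) e (suc s) (s<s s<t) = replicate-entry (h ∘ suc) t (∧-trueʳ e) s s<t

-- Walks in the Weyl chamber

_⊕_ : (ℕ → ℕ) → ℕ → (ℕ → ℕ)
(ν ⊕ r) i = if r ≡ᵇ i then suc (ν i) else ν i

⊕-cong : ∀ {ν ν'} → ν ≗ ν' → ∀ r → ν ⊕ r ≗ ν' ⊕ r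
⊕-cong e r i = cong (λ x → if r ≡ᵇ i then suc x else x) (e i)

⊕-≤ : ∀ ν r i → ν i ≤ (ν ⊕ r) i
⊕-≤ ν r i with r ≡ᵇ i
... | true  = n≤1+n (ν i)
... | false = ≤-refl

∑-⊕ : ∀ N ν r → r < N → ∑[ i < N ] (ν ⊕ r) i ≡ suc (∑[ i < N ] ν i)
∑-⊕ (suc N) ν zero    _         = refl
∑-⊕ (suc N) ν (suc r) (s<s r<N) = trans (cong (ν 0 +_) (∑-⊕ N (ν ∘ suc) r r<N)) (+-suc (ν 0) _)

-- A state ν lists row lengths; walks φ ν m adds up the weight φ of the endpoints of all m-box
-- extensions of ν whose intermediate shapes, restricted to the first ℓ rows, are partitions.
module Chamber (ℓ : ℕ) where

  shape : (ℕ → ℕ) → List ℕ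
  shape ν = applyUpTo ν ℓ

  size : (ℕ → ℕ) → ℕ
  size ν = sum (shape ν)

  valid : (ℕ → ℕ) → Bool
  valid ν = decreasing (shape ν)

  walks : ((ℕ → ℕ) → ℕ) → (ℕ → ℕ) → ℕ → ℕ
  walks φ ν zero    = if valid ν then φ ν else 0
  walks φ ν (suc m) = if valid ν then ∑[ r < ℓ ] walks φ (ν ⊕ r) m else 0

  hits : List ℕ → (ℕ → ℕ) → ℕ
  hits μ ν = 𝟙 (eqList (shape ν) μ)

  valid-cong : ∀ {ν ν'} → ν ≗ ν' → valid ν ≡ valid ν'
  valid-cong e = cong decreasing (applyUpTo-cong e ℓ)

  hits-cong : ∀ μ {ν ν'} → ν ≗ ν' → hits μ ν ≡ hits μ ν'
  hits-cong μ e = cong (λ l → 𝟙 (eqList l μ)) (applyUpTo-cong e ℓ)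

  size-⊕ : ∀ ν r → r < ℓ → size (ν ⊕ r) ≡ suc (size ν)
  size-⊕ = ∑-⊕ ℓ

  walks-invalid : ∀ φ ν m → valid ν ≡ false → walks φ ν m ≡ 0
  walks-invalid φ ν zero    e rewrite e = refl
  walks-invalid φ ν (suc m) e rewrite e = refl

  walks-increasing-row : ∀ φ ν m s → suc s < ℓ → ν s < ν (suc s) → walks φ ν m ≡ 0
  walks-increasing-row φ ν m s s<ℓ increase with valid ν in v
  ... | true  = ⊥-elim (<⇒≱ increase (decreasing-entry ν ℓ v s s<ℓ))
  ... | false = walks-invalid φ ν m v

  walks-vanish : ∀ φ ν m → (∀ ν' → (∀ i → ν i ≤ ν' i) → φ ν' ≡ 0) → walks φ ν m ≡ 0
  walks-vanish φ ν zero    z = if-0 (valid ν) (z ν (λ _ → ≤-refl))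
  walks-vanish φ ν (suc m) z = if-0 (valid ν) (∑-zero ℓ vanish)
    where
    vanish : ∀ r → r < ℓ → walks φ (ν ⊕ r) m ≡ 0
    vanish r _ = walks-vanish φ (ν ⊕ r) m (λ ν' le → z ν' (λ i → ≤-trans (⊕-≤ ν r i) (le i)))

  walks-ext : ∀ φ → (∀ {ν ν'} → ν ≗ ν' → φ ν ≡ φ ν') →
              ∀ {ν ν'} m → ν ≗ ν' → walks φ ν m ≡ walks φ ν' m
  walks-ext φ φ-ext zero    e = cong₂ (if_then_else 0) (valid-cong e) (φ-ext e)
  walks-ext φ φ-ext (suc m) e =
    cong₂ (if_then_else 0) (valid-cong e) (∑-cong ℓ (λ r _ → walks-ext φ φ-ext m (⊕-cong e r)))

  walks-cong : ∀ φ ψ s → (∀ ν → valid ν ≡ true → size ν ≡ s → φ ν ≡ ψ ν) →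
               ∀ ν m → size ν + m ≡ s → walks φ ν m ≡ walks ψ ν m
  walks-cong φ ψ s agree ν zero    eq with valid ν in v
  ... | true  = agree ν v (trans (sym (+-identityʳ (size ν))) eq)
  ... | false = refl
  walks-cong φ ψ s agree ν (suc m) eq = cong (if valid ν then_else 0) (∑-cong ℓ step)
    where
    step : ∀ r → r < ℓ → walks φ (ν ⊕ r) m ≡ walks ψ (ν ⊕ r) m
    step r r<ℓ = walks-cong φ ψ s agree (ν ⊕ r) m
                   (trans (cong (_+ m) (size-⊕ ν r r<ℓ)) (trans (sym (+-suc (size ν) m)) eq))

  walks-+ : ∀ φ ψ ν m → walks φ ν m + walks ψ ν m ≡ walks (λ ν' → φ ν' + ψ ν') ν m
  walks-+ φ ψ ν zero    = if-+ (valid ν) _ _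
  walks-+ φ ψ ν (suc m) =
    trans (if-+ (valid ν) _ _)
          (cong (if valid ν then_else 0) (trans (sym (∑-+ ℓ _ _)) (∑-cong ℓ (λ r _ → walks-+ φ ψ (ν ⊕ r) m))))

  walks-∑ : ∀ N (Φ : ℕ → (ℕ → ℕ) → ℕ) ν m →
            ∑[ i < N ] walks (Φ i) ν m ≡ walks (λ ν' → ∑[ i < N ] Φ i ν') ν m
  walks-∑ zero    Φ ν m = sym (walks-vanish (λ _ → 0) ν m (λ _ _ → refl))
  walks-∑ (suc N) Φ ν m = trans (cong (walks (Φ 0) ν m +_) (walks-∑ N (Φ ∘ suc) ν m)) (walks-+ (Φ 0) _ ν m)

  walks-last-step : ∀ φ ν m → walks φ ν (suc m) ≡ walks (λ ν' → ∑[ r < ℓ ] walks φ (ν' ⊕ r) 0) ν m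
  walks-last-step φ ν zero    = refl
  walks-last-step φ ν (suc m) = cong (if valid ν then_else 0) (∑-cong ℓ (λ r _ → walks-last-step φ (ν ⊕ r) m))

  reached : (ℕ → ℕ) → List ℕ → (ℕ → ℕ)
  reached ν w i = ν i + count i w

  completes : List ℕ → (ℕ → ℕ) → List ℕ → Bool
  completes μ ν w = eqList (shape (reached ν w)) μ ∧ allB (map (λ p → valid (reached ν p)) (prefixes w))

  reached-[] : ∀ ν → reached ν [] ≗ ν
  reached-[] ν i = +-identityʳ (ν i)

  reached-∷ : ∀ ν r w → reached ν (r ∷ w) ≗ reached (ν ⊕ r) w
  reached-∷ ν r w i with r ≡ᵇ i
  ... | true  = +-suc (ν i) (count i w)
  ... | false = refl

  completes-∷ : ∀ μ ν r w → completes μ ν (r ∷ w) ≡ valid ν ∧ completes μ (ν ⊕ r) w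
  completes-∷ μ ν r w = begin
    eqList (shape (reached ν (r ∷ w))) μ ∧ (valid (reached ν []) ∧ allB (map V (map (r ∷_) (prefixes w))))
      ≡⟨ cong₂ (λ e a → e ∧ (valid (reached ν []) ∧ allB a))
               (cong (λ l → eqList l μ) (applyUpTo-cong (reached-∷ ν r w) ℓ))
               (trans (sym (map-∘ (prefixes w))) (map-cong (λ p → valid-cong (reached-∷ ν r p)) (prefixes w))) ⟩
    E ∧ (valid (reached ν []) ∧ A)
      ≡⟨ cong (λ v → E ∧ (v ∧ A)) (valid-cong (reached-[] ν)) ⟩
    E ∧ (valid ν ∧ A)
      ≡⟨ trans (sym (∧-assoc E (valid ν) A)) (trans (cong (_∧ A) (∧-comm E (valid ν))) (∧-assoc (valid ν) E A)) ⟩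
    valid ν ∧ (E ∧ A) ∎
    where
    open ≡-Reasoning
    V : List ℕ → Bool
    V p = valid (reached ν p)
    E = eqList (shape (reached (ν ⊕ r) w)) μ
    A = allB (map (λ p → valid (reached (ν ⊕ r) p)) (prefixes w))

  count-completions : ∀ μ m ν → sum (map (𝟙 ∘ completes μ ν) (words m ℓ)) ≡ walks (hits μ) ν m
  count-completions μ zero ν = begin
    𝟙 (eqList (shape (reached ν [])) μ ∧ (valid (reached ν []) ∧ true)) + 0
      ≡⟨ +-identityʳ _ ⟩
    𝟙 (eqList (shape (reached ν [])) μ ∧ (valid (reached ν []) ∧ true))
      ≡⟨ cong₂ (λ l v → 𝟙 (eqList l μ ∧ v)) (applyUpTo-cong (reached-[] ν) ℓ)
               (trans (∧-identityʳ _) (valid-cong (reached-[] ν))) ⟩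
    𝟙 (eqList (shape ν) μ ∧ valid ν)
      ≡⟨ if-𝟙 (valid ν) (eqList (shape ν) μ) ⟨
    walks (hits μ) ν zero ∎
    where open ≡-Reasoning
  count-completions μ (suc m) ν = begin
    sum (map (𝟙 ∘ completes μ ν) (concatMap (λ r → map (r ∷_) (words m ℓ)) (upTo ℓ)))
      ≡⟨ sum-map-concatMap _ _ (upTo ℓ) ⟩
    sum (map (λ r → sum (map (𝟙 ∘ completes μ ν) (map (r ∷_) (words m ℓ)))) (upTo ℓ))
      ≡⟨ cong sum (map-cong (λ r → cong sum (sym (map-∘ (words m ℓ)))) (upTo ℓ)) ⟩
    sum (map (λ r → sum (map (λ w → 𝟙 (completes μ ν (r ∷ w))) (words m ℓ))) (upTo ℓ))
      ≡⟨ cong sum (map-cong (λ r → cong sum (map-cong (λ w → first-step r w) (words m ℓ))) (upTo ℓ)) ⟩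
    sum (map (λ r → sum (map (λ w → if valid ν then 𝟙 (completes μ (ν ⊕ r) w) else 0) (words m ℓ))) (upTo ℓ))
      ≡⟨ cong sum (map-cong (λ r → sum-map-if (valid ν) _ (words m ℓ)) (upTo ℓ)) ⟩
    sum (map (λ r → if valid ν then sum (map (𝟙 ∘ completes μ (ν ⊕ r)) (words m ℓ)) else 0) (upTo ℓ))
      ≡⟨ sum-map-if (valid ν) _ (upTo ℓ) ⟩
    (if valid ν then sum (map (λ r → sum (map (𝟙 ∘ completes μ (ν ⊕ r)) (words m ℓ))) (upTo ℓ)) else 0)
      ≡⟨ cong (if valid ν then_else 0) (trans (sum-map-upTo _ ℓ) (∑-cong ℓ (λ r _ → count-completions μ m (ν ⊕ r)))) ⟩
    walks (hits μ) ν (suc m) ∎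
    where
    open ≡-Reasoning
    first-step : ∀ r w → 𝟙 (completes μ ν (r ∷ w)) ≡ (if valid ν then 𝟙 (completes μ (ν ⊕ r) w) else 0)
    first-step r w = trans (cong 𝟙 (completes-∷ μ ν r w)) (𝟙-∧ (valid ν) _)

length-filter : ∀ {A : Set} (p : A → Bool) xs → length (filter (T? ∘ p) xs) ≡ sum (map (𝟙 ∘ p) xs)
length-filter p []       = refl
length-filter p (x ∷ xs) with p x
... | true  = cong suc (length-filter p xs)
... | false = length-filter p xs

f≡walks : ∀ μ → f μ ≡ Chamber.walks (length μ) (Chamber.hits (length μ) μ) (λ _ → 0) (sum μ)
f≡walks μ = trans (length-filter (isSYTWord μ) (words (sum μ) (length μ)))
                  (Chamber.count-completions (length μ) μ (sum μ) (λ _ → 0))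

-- The left-hand side: three rows of equal parity

module C₃ = Chamber 3

equalParities : ℕ → ℕ → ℕ → Bool
equalParities a b c = (parity a ≡ᵇ parity b) ∧ (parity b ≡ᵇ parity c)

sameParity : (ℕ → ℕ) → Bool
sameParity ν = equalParities (ν 0) (ν 1) (ν 2)

evenWalks : (ℕ → ℕ) → ℕ → ℕ
evenWalks = C₃.walks (𝟙 ∘ sameParity)

xShape : ℕ → ℕ → ℕ → List ℕ
xShape n a b = a ∷ b ∷ n ∸ (a + b) ∷ []

xTerm : ℕ → ℕ → ℕ → (ℕ → ℕ) → ℕ
xTerm n a b ν = if inX n a b (n ∸ (a + b)) then C₃.hits (xShape n a b) ν else 0

xTerm-off-diagonal : ∀ n a b ν → ν 0 ≢ a ⊎ ν 1 ≢ b → xTerm n a b ν ≡ 0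
xTerm-off-diagonal n a b ν (inj₁ ν₀≢a) rewrite ≢⇒≡ᵇ-false ν₀≢a = if-eta (inX n a b (n ∸ (a + b)))
xTerm-off-diagonal n a b ν (inj₂ ν₁≢b) rewrite ≢⇒≡ᵇ-false ν₁≢b =
  if-0 (inX n a b (n ∸ (a + b))) (cong 𝟙 (∧-zeroʳ (ν 0 ≡ᵇ a)))

xWeight : ℕ → (ℕ → ℕ) → ℕ
xWeight n ν = ∑[ a < suc n ] ∑[ b < suc n ] xTerm n a b ν

xWeight≡sameParity : ∀ n ν → C₃.valid ν ≡ true → C₃.size ν ≡ n → xWeight n ν ≡ 𝟙 (sameParity ν)
xWeight≡sameParity n ν v s =
  trans (∑-select (suc n) {λ a → ∑[ b < suc n ] xTerm n a b ν} (ν 0) (s≤s ν₀≤n) other-a)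
 (trans (∑-select (suc n) {λ b → xTerm n (ν 0) b ν} (ν 1) (s≤s ν₁≤n) other-b)
        (diagonal (ν 0) (ν 1) (ν 2) (trans (regroup (ν 0) (ν 1) (ν 2)) s) v))
  where
  ν₀≤n : ν 0 ≤ n
  ν₀≤n = subst (ν 0 ≤_) s (m≤m+n (ν 0) _)
  ν₁≤n : ν 1 ≤ n
  ν₁≤n = subst (ν 1 ≤_) s (≤-trans (m≤m+n (ν 1) _) (m≤n+m _ (ν 0)))
  regroup : ∀ a b c → a + b + c ≡ a + (b + (c + 0))
  regroup = solve-∀
  other-a : ∀ a → a < suc n → a ≢ ν 0 → ∑[ b < suc n ] xTerm n a b ν ≡ 0
  other-a a _ a≢ = ∑-zero (suc n) {λ b → xTerm n a b ν} (λ b _ → xTerm-off-diagonal n a b ν (inj₁ (a≢ ∘ sym)))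
  other-b : ∀ b → b < suc n → b ≢ ν 1 → xTerm n (ν 0) b ν ≡ 0
  other-b b _ b≢ = xTerm-off-diagonal n (ν 0) b ν (inj₂ (b≢ ∘ sym))
  diagonal : ∀ a b c → a + b + c ≡ n → (b ≤ᵇ a) ∧ ((c ≤ᵇ b) ∧ true) ≡ true →
    (if inX n a b (n ∸ (a + b)) then 𝟙 ((a ≡ᵇ a) ∧ ((b ≡ᵇ b) ∧ ((c ≡ᵇ n ∸ (a + b)) ∧ true))) else 0)
      ≡ 𝟙 (equalParities a b c)
  diagonal a b c refl v
    rewrite m+n∸m≡n (a + b) c | ≡ᵇ-refl a | ≡ᵇ-refl b | ≡ᵇ-refl c | ≡ᵇ-refl (a + b + c)
    with b ≤ᵇ a | c ≤ᵇ b
  ... | true | true = refl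

sumX≡evenWalks : ∀ n → sumX n ≡ evenWalks (λ _ → 0) n
sumX≡evenWalks n = begin
  sumX n
    ≡⟨ sum-concatMap (λ a → map (term a) (upTo (suc n))) (upTo (suc n)) ⟩
  sum (map (λ a → sum (map (term a) (upTo (suc n)))) (upTo (suc n)))
    ≡⟨ trans (cong sum (map-cong (λ a → sum-map-upTo (term a) (suc n)) (upTo (suc n)))) (sum-map-upTo _ (suc n)) ⟩
  ∑[ a < suc n ] ∑[ b < suc n ] term a b
    ≡⟨ ∑-cong (suc n) (λ a _ → ∑-cong (suc n) (λ b _ → term≡walks a b)) ⟩
  ∑[ a < suc n ] ∑[ b < suc n ] C₃.walks (xTerm n a b) (λ _ → 0) n
    ≡⟨ ∑-cong (suc n) (λ a _ → C₃.walks-∑ (suc n) (xTerm n a) (λ _ → 0) n) ⟩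
  ∑[ a < suc n ] C₃.walks (λ ν → ∑[ b < suc n ] xTerm n a b ν) (λ _ → 0) n
    ≡⟨ C₃.walks-∑ (suc n) (λ a ν → ∑[ b < suc n ] xTerm n a b ν) (λ _ → 0) n ⟩
  C₃.walks (xWeight n) (λ _ → 0) n
    ≡⟨ C₃.walks-cong _ _ n (xWeight≡sameParity n) (λ _ → 0) n refl ⟩
  evenWalks (λ _ → 0) n ∎
  where
  open ≡-Reasoning
  term : ℕ → ℕ → ℕ
  term a b = if inX n a b (n ∸ (a + b)) then f (xShape n a b) else 0
  term≡walks : ∀ a b → term a b ≡ C₃.walks (xTerm n a b) (λ _ → 0) n
  term≡walks a b with inX n a b (n ∸ (a + b)) in e
  ... | true  = trans (f≡walks (xShape n a b)) (cong (C₃.walks (C₃.hits (xShape n a b)) (λ _ → 0)) size≡n)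
    where
    size≡n : a + (b + (n ∸ (a + b) + 0)) ≡ n
    size≡n = trans (cong (λ x → a + (b + x)) (+-identityʳ _))
                   (trans (sym (+-assoc a b _)) (≡ᵇ⇒≡ _ n (≡true⇒T (∧-trueˡ e))))
  ... | false = sym (C₃.walks-vanish (λ _ → 0) (λ _ → 0) n (λ _ _ → refl))

parity-cases : ∀ a → (parity a ≡ 0 × parity (suc a) ≡ 1) ⊎ (parity a ≡ 1 × parity (suc a) ≡ 0)
parity-cases zero    = inj₁ (refl , refl)
parity-cases (suc a) with parity-cases a
... | inj₁ (p , q) = inj₂ (q , p)
... | inj₂ (p , q) = inj₁ (q , p)

≤∧parity≢⇒<ᵇ : ∀ {x y} → y ≤ x → parity x ≢ parity y → (y <ᵇ x) ≡ true
≤∧parity≢⇒<ᵇ y≤x p≢ = T⇒≡true (<⇒<ᵇ (≤∧≢⇒< y≤x (p≢ ∘ cong parity ∘ sym)))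

-- If the parities are not all equal, exactly one row has the odd parity out, and one box added to
-- it equalises them. That move is legal: a row whose parity differs from the row above (below) it
-- is strictly shorter (longer) than it.
equalParities-exactly-one : ∀ a b c → b ≤ a → c ≤ b →
  𝟙 (equalParities (suc a) b c ∧ decreasing (suc a ∷ b ∷ c ∷ []))
  + (𝟙 (equalParities a (suc b) c ∧ decreasing (a ∷ suc b ∷ c ∷ []))
  + (𝟙 (equalParities a b (suc c) ∧ decreasing (a ∷ b ∷ suc c ∷ [])) + 0))
  + 𝟙 (equalParities a b c) ≡ 1
equalParities-exactly-one a b c b≤a c≤b
  rewrite T⇒≡true (≤⇒≤ᵇ (m≤n⇒m≤1+n b≤a)) | T⇒≡true (≤⇒≤ᵇ c≤b)
        | T⇒≡true (≤⇒≤ᵇ (m≤n⇒m≤1+n c≤b)) | T⇒≡true (≤⇒≤ᵇ b≤a)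
  with parity-cases a | parity-cases b | parity-cases c
... | inj₁ (a₀ , a₁) | inj₁ (b₀ , b₁) | inj₁ (c₀ , c₁) rewrite a₁ | b₁ | c₁ | a₀ | b₀ | c₀ = refl
... | inj₂ (a₀ , a₁) | inj₂ (b₀ , b₁) | inj₂ (c₀ , c₁) rewrite a₁ | b₁ | c₁ | a₀ | b₀ | c₀ = refl
... | inj₁ (a₀ , a₁) | inj₂ (b₀ , b₁) | inj₂ (c₀ , c₁) rewrite a₁ | b₁ | c₁ | a₀ | b₀ | c₀ = refl
... | inj₂ (a₀ , a₁) | inj₁ (b₀ , b₁) | inj₁ (c₀ , c₁) rewrite a₁ | b₁ | c₁ | a₀ | b₀ | c₀ = refl
... | inj₁ (a₀ , a₁) | inj₂ (b₀ , b₁) | inj₁ (c₀ , c₁)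
  rewrite ≤∧parity≢⇒<ᵇ b≤a (λ e → 0≢1+n (trans (sym a₀) (trans e b₀)))
        | a₁ | b₁ | c₁ | a₀ | b₀ | c₀ = refl
... | inj₂ (a₀ , a₁) | inj₁ (b₀ , b₁) | inj₂ (c₀ , c₁)
  rewrite ≤∧parity≢⇒<ᵇ b≤a (λ e → 1+n≢0 (trans (sym a₀) (trans e b₀)))
        | a₁ | b₁ | c₁ | a₀ | b₀ | c₀ = refl
... | inj₁ (a₀ , a₁) | inj₁ (b₀ , b₁) | inj₂ (c₀ , c₁)
  rewrite ≤∧parity≢⇒<ᵇ c≤b (λ e → 0≢1+n (trans (sym b₀) (trans e c₀)))
        | a₁ | b₁ | c₁ | a₀ | b₀ | c₀ = refl
... | inj₂ (a₀ , a₁) | inj₂ (b₀ , b₁) | inj₁ (c₀ , c₁)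
  rewrite ≤∧parity≢⇒<ᵇ c≤b (λ e → 1+n≢0 (trans (sym b₀) (trans e c₀)))
        | a₁ | b₁ | c₁ | a₀ | b₀ | c₀ = refl

sameParity-exactly-one : ∀ ν → C₃.valid ν ≡ true →
                         ∑[ r < 3 ] C₃.walks (𝟙 ∘ sameParity) (ν ⊕ r) 0 + 𝟙 (sameParity ν) ≡ 1
sameParity-exactly-one ν v =
  trans (cong₂ (λ x y → x + y + 𝟙 (sameParity ν))
               (if-𝟙 (decreasing (suc a ∷ b ∷ c ∷ [])) (equalParities (suc a) b c))
               (cong₂ _+_ (if-𝟙 (decreasing (a ∷ suc b ∷ c ∷ [])) (equalParities a (suc b) c))
                          (cong (_+ 0) (if-𝟙 (decreasing (a ∷ b ∷ suc c ∷ [])) (equalParities a b (suc c))))))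
        (equalParities-exactly-one a b c (decreasing-entry ν 3 v 0 (s<s z<s)) (decreasing-entry ν 3 v 1 ≤-refl))
  where
  a = ν 0
  b = ν 1
  c = ν 2

chamberWalks : (ℕ → ℕ) → ℕ → ℕ
chamberWalks = C₃.walks (λ _ → 1)

evenWalks-pair-sum : ∀ ν m → evenWalks ν (suc m) + evenWalks ν m ≡ chamberWalks ν m
evenWalks-pair-sum ν m =
  trans (cong (_+ evenWalks ν m) (C₃.walks-last-step (𝟙 ∘ sameParity) ν m))
 (trans (C₃.walks-+ _ (𝟙 ∘ sameParity) ν m)
        (C₃.walks-cong _ _ (C₃.size ν + m) (λ ν' v _ → sameParity-exactly-one ν' v) ν m refl))

-- Three-row walks and Motzkin paths

lower : (ℕ → ℕ) → ℕ → ℕ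
lower E zero    = 0
lower E (suc h) = E h

lower-cong : ∀ {E E'} → (∀ h → E h ≡ E' h) → ∀ h → lower E h ≡ lower E' h
lower-cong e zero    = refl
lower-cong e (suc h) = e h

motzkinStep : (ℕ → ℕ) → ℕ → ℕ
motzkinStep E h = E (suc h) + (lower E h + E h)

motzkin : ℕ → ℕ → ℕ
motzkin h zero    = 𝟙 (h ≡ᵇ 0)
motzkin h (suc m) = motzkinStep (λ h' → motzkin h' m) h

quadrantStep : (ℕ → ℕ → ℕ) → ℕ → ℕ → ℕ
quadrantStep F x y = F (suc x) y + (lower (λ x' → F x' (suc y)) x + lower (F x) y)

quadrantStep-cong : ∀ {F G} → (∀ x y → F x y ≡ G x y) → ∀ x y → quadrantStep F x y ≡ quadrantStep G x y
quadrantStep-cong e x y =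
  cong₂ _+_ (e (suc x) y) (cong₂ _+_ (lower-cong (λ x' → e x' (suc y)) x) (lower-cong (e x) y))

quadrantWalks : ℕ → ℕ → ℕ → ℕ
quadrantWalks x y zero    = 1
quadrantWalks x y (suc m) = quadrantStep (λ x' y' → quadrantWalks x' y' m) x y

-- Rows beyond the third are 0, so that adding a box to one of the three rows gives another state₃.
state₃ : ℕ → ℕ → ℕ → (ℕ → ℕ)
state₃ a b c 0 = a
state₃ a b c 1 = b
state₃ a b c 2 = c
state₃ a b c (suc (suc (suc _))) = 0

state₃-valid : ∀ x y c → C₃.valid (state₃ (x + (y + c)) (y + c) c) ≡ true
state₃-valid x y c rewrite T⇒≡true (≤⇒≤ᵇ (m≤n+m (y + c) x)) | T⇒≡true (≤⇒≤ᵇ (m≤n+m c y)) = refl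

chamberWalks-ext : ∀ {ν ν'} m → ν ≗ ν' → chamberWalks ν m ≡ chamberWalks ν' m
chamberWalks-ext = C₃.walks-ext (λ _ → 1) (λ _ → refl)

chamberWalks≡quadrantWalks : ∀ m x y c → chamberWalks (state₃ (x + (y + c)) (y + c) c) m ≡ quadrantWalks x y m
chamberWalks≡quadrantWalks zero    x y c rewrite state₃-valid x y c = refl
chamberWalks≡quadrantWalks (suc m) x y c rewrite state₃-valid x y c =
  cong₂ _+_ first (cong₂ _+_ (second x) (trans (+-identityʳ _) (third y)))
  where
  first : chamberWalks (state₃ (x + (y + c)) (y + c) c ⊕ 0) m ≡ quadrantWalks (suc x) y m
  first = trans (chamberWalks-ext m (λ { 0 → refl ; 1 → refl ; 2 → refl ; (suc (suc (suc _))) → refl }))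
                (chamberWalks≡quadrantWalks m (suc x) y c)
  second : ∀ x → chamberWalks (state₃ (x + (y + c)) (y + c) c ⊕ 1) m ≡ lower (λ x' → quadrantWalks x' (suc y) m) x
  second zero     = C₃.walks-increasing-row _ _ m 0 (s<s z<s) (n<1+n (y + c))
  second (suc x') =
    trans (chamberWalks-ext m (λ { 0 → sym (+-suc x' (y + c)) ; 1 → refl ; 2 → refl ; (suc (suc (suc _))) → refl }))
          (chamberWalks≡quadrantWalks m x' (suc y) c)
  third : ∀ y → chamberWalks (state₃ (x + (y + c)) (y + c) c ⊕ 2) m ≡ lower (λ y' → quadrantWalks x y' m) y
  third zero     = C₃.walks-increasing-row _ _ m 1 ≤-refl (n<1+n c)
  third (suc y') =
    trans (chamberWalks-ext m (λ { 0 → cong (x +_) (sym (+-suc y' c)) ; 1 → sym (+-suc y' c) ; 2 → refl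
                                 ; (suc (suc (suc _))) → refl }))
          (chamberWalks≡quadrantWalks m x y' (suc c))

segment : (ℕ → ℕ) → ℕ → ℕ → ℕ
segment E s y = ∑[ j < suc y ] E (s + j)

block : (ℕ → ℕ) → ℕ → ℕ → ℕ
block E x y = ∑[ i < suc x ] segment E i y

module _ (E : ℕ → ℕ) where

  private
    shifted : ℕ → ℕ → ℕ
    shifted x y = ∑[ i < suc x ] segment E (suc i) y

  segment-shift : ∀ s y → segment E s (suc y) ≡ E s + segment E (suc s) y
  segment-shift s y = cong₂ _+_ (cong E (+-identityʳ s)) (∑-cong (suc y) (λ j _ → cong E (+-suc s j)))

  block-extend : ∀ x y → block E x (suc y) ≡ segment E 0 x + shifted x y
  block-extend x y = trans (∑-cong (suc x) (λ i _ → segment-shift i y)) (∑-+ (suc x) E (λ i → segment E (suc i) y))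

  block-base : ∀ x → block E x 0 ≡ segment E 0 x
  block-base x = ∑-cong (suc x) (λ i _ → trans (+-identityʳ _) (cong E (+-identityʳ i)))

  segment-motzkinStep : ∀ s y → segment (motzkinStep E) s y ≡ segment E (suc s) y + (segment (lower E) s y + segment E s y)
  segment-motzkinStep s y =
    trans (∑-+ (suc y) (λ j → E (suc s + j)) (λ j → lower E (s + j) + E (s + j)))
          (cong (segment E (suc s) y +_) (∑-+ (suc y) (λ j → lower E (s + j)) (λ j → E (s + j))))

  -- Here segment (lower E) (suc i) y reduces to segment E i y, and segment (lower E) 0 y to
  -- lower (segment E 0) y, so in each case only block-extend and block-base are needed.
  quadrantStep-block : ∀ x y →
    shifted x y + (∑[ i < suc x ] segment (lower E) i y + block E x y) ≡ quadrantStep (block E) x y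
  quadrantStep-block zero zero = solve₂ (shifted 0 0) (segment E 0 0)
    where solve₂ : ∀ u c → u + ((0 + 0) + (c + 0)) ≡ (c + u) + (0 + 0)
          solve₂ = solve-∀
  quadrantStep-block zero (suc y) = solve₃ (shifted 0 (suc y)) (segment E 0 (suc y)) (segment E 0 y)
    where solve₃ : ∀ u c c' → u + ((c' + 0) + (c + 0)) ≡ (c + u) + (c' + 0)
          solve₃ = solve-∀
  quadrantStep-block (suc x) zero = begin
    u + ((0 + block E x 0) + (c + shifted x 0))   ≡⟨ cong (λ z → u + (z + (c + shifted x 0))) (block-base x) ⟩
    u + (segment E 0 x + (c + shifted x 0))       ≡⟨ solve₄ u c (segment E 0 x) (shifted x 0) ⟩
    (c + u) + ((segment E 0 x + shifted x 0) + 0) ≡⟨ cong (λ z → (c + u) + (z + 0)) (block-extend x 0) ⟨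
    (c + u) + (block E x 1 + 0)                   ∎
    where open ≡-Reasoning
          u = shifted (suc x) 0
          c = segment E 0 0
          solve₄ : ∀ u c p s → u + (p + (c + s)) ≡ (c + u) + ((p + s) + 0)
          solve₄ = solve-∀
  quadrantStep-block (suc x) (suc y) = begin
    u + ((a + block E x (suc y)) + (b + s'))      ≡⟨ cong (λ z → u + ((a + z) + (b + s'))) (block-extend x y) ⟩
    u + ((a + (p + s)) + (b + s'))                ≡⟨ solve₆ u a b p s s' ⟩
    (b + u) + ((p + s') + (a + s))                ≡⟨ cong (λ z → (b + u) + (z + (a + s))) (block-extend x (suc y)) ⟨
    (b + u) + (block E x (suc (suc y)) + (a + s)) ∎
    where open ≡-Reasoning
          u = shifted (suc x) (suc y)
          a = segment E 0 y
          b = segment E 0 (suc y)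
          p = segment E 0 x
          s = shifted x y
          s' = shifted x (suc y)
          solve₆ : ∀ u a b p s s' → u + ((a + (p + s)) + (b + s')) ≡ (b + u) + ((p + s') + (a + s))
          solve₆ = solve-∀

  block-step : ∀ x y → block (motzkinStep E) x y ≡ quadrantStep (block E) x y
  block-step x y =
    trans (∑-cong (suc x) (λ i _ → segment-motzkinStep i y))
   (trans (∑-+ (suc x) (λ i → segment E (suc i) y) (λ i → segment (lower E) i y + segment E i y))
   (trans (cong (shifted x y +_) (∑-+ (suc x) (λ i → segment (lower E) i y) (λ i → segment E i y)))
          (quadrantStep-block x y)))

block-initial : ∀ x y → block (λ h → motzkin h 0) x y ≡ 1
block-initial x y =
  cong₂ _+_ (cong suc (∑-zero y (λ _ _ → refl))) (∑-zero x (λ _ _ → ∑-zero (suc y) (λ _ _ → refl)))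

quadrantWalks≡block : ∀ m x y → quadrantWalks x y m ≡ block (λ h → motzkin h m) x y
quadrantWalks≡block zero    x y = sym (block-initial x y)
quadrantWalks≡block (suc m) x y =
  trans (quadrantStep-cong (quadrantWalks≡block m) x y) (sym (block-step (λ h → motzkin h m) x y))

chamberWalks≡motzkin : ∀ m → chamberWalks (λ _ → 0) m ≡ motzkin 0 m
chamberWalks≡motzkin m =
  trans (chamberWalks-ext m (λ { 0 → refl ; 1 → refl ; 2 → refl ; (suc (suc (suc _))) → refl }))
 (trans (chamberWalks≡quadrantWalks m 0 0 0)
        (trans (quadrantWalks≡block m 0 0) (trans (+-identityʳ _) (+-identityʳ _))))

-- The right-hand side: hooks with two long rows

-- Motzkin paths of length m from height h down to 0 with no flat step before the first down step.
riordan : ℕ → ℕ → ℕ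
riordan h zero    = 0
riordan h (suc m) = riordan (suc h) m + lower (λ h' → motzkin h' m) h

riordan-pair-sum : ∀ m h →
  riordan h (2 + m) + riordan h (1 + m) ≡ motzkin h (1 + m) + lower (λ h' → motzkin h' (1 + m)) h
riordan-pair-sum zero h = rearrange (motzkin h 0) (lower (λ h' → motzkin h' 0) h) (lower (λ h' → motzkin h' 1) h)
  where rearrange : ∀ M L₀ L₁ → (M + L₁) + L₀ ≡ (L₀ + M) + L₁
        rearrange = solve-∀
riordan-pair-sum (suc m) h = begin
  (riordan (suc h) (2 + m) + L₂) + (riordan (suc h) (1 + m) + L₁)
    ≡⟨ +-interchange (riordan (suc h) (2 + m)) L₂ _ L₁ ⟩
  (riordan (suc h) (2 + m) + riordan (suc h) (1 + m)) + (L₂ + L₁)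
    ≡⟨ cong (_+ (L₂ + L₁)) (riordan-pair-sum m (suc h)) ⟩
  (motzkin (suc h) (1 + m) + motzkin h (1 + m)) + (L₂ + L₁)
    ≡⟨ rearrange (motzkin (suc h) (1 + m)) (motzkin h (1 + m)) L₁ L₂ ⟩
  motzkin h (2 + m) + L₂ ∎
  where
  open ≡-Reasoning
  L₁ = lower (λ h' → motzkin h' (1 + m)) h
  L₂ = lower (λ h' → motzkin h' (2 + m)) h
  rearrange : ∀ u f l₁ l₂ → (u + f) + (l₂ + l₁) ≡ (u + (l₁ + f)) + l₂
  rearrange = solve-∀

-- Completions to the shape (k, k, 1^t) from a tableau with rows (d + b, b) and j boxes in the leg.
hookWalks : (k t : ℕ) → ℕ → ℕ → ℕ → ℕ → ℕ
hookWalks k t d b j zero    = 𝟙 ((b ≡ᵇ k) ∧ ((d ≡ᵇ 0) ∧ (j ≡ᵇ t)))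
hookWalks k t d b j (suc m) =
  hookWalks k t (suc d) b j m
  + (lower (λ d' → hookWalks k t d' (suc b) j m) d
  + (if 0 <ᵇ b then hookWalks k t d b (suc j) m else 0))

hookWalks-overfull : ∀ k t m d b j → t < j → hookWalks k t d b j m ≡ 0
hookWalks-overfull k t zero d b j t<j rewrite ≢⇒≡ᵇ-false (<⇒≢ t<j ∘ sym) =
  cong 𝟙 (trans (cong ((b ≡ᵇ k) ∧_) (∧-zeroʳ (d ≡ᵇ 0))) (∧-zeroʳ (b ≡ᵇ k)))
hookWalks-overfull k t (suc m) d b j t<j =
  cong₂ _+_ (hookWalks-overfull k t m (suc d) b j t<j)
            (cong₂ _+_ (down d) (if-0 (0 <ᵇ b) (hookWalks-overfull k t m d b (suc j) (m<n⇒m<1+n t<j))))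
  where
  down : ∀ d → lower (λ d' → hookWalks k t d' (suc b) j m) d ≡ 0
  down zero    = refl
  down (suc d) = hookWalks-overfull k t m d (suc b) j t<j

leg : ℕ → ℕ → ℕ
leg j i = 𝟙 (i <ᵇ j)

leg-eqList : ∀ j t → j ≤ t → eqList (applyUpTo (leg j) t) (replicate t 1) ≡ (j ≡ᵇ t)
leg-eqList zero    zero    _         = refl
leg-eqList zero    (suc t) _         = refl
leg-eqList (suc j) (suc t) (s≤s j≤t) = leg-eqList j t j≤t

leg-decreasing : ∀ c j t → (0 < j → 0 < c) → decreasing (c ∷ applyUpTo (leg j) t) ≡ true
leg-decreasing c zero    zero    _   = refl
leg-decreasing c (suc j) zero    _   = refl
leg-decreasing c zero    (suc t) _   = leg-decreasing 0 0 t (λ ())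
leg-decreasing c (suc j) (suc t) c>0 rewrite T⇒≡true (≤⇒≤ᵇ (c>0 z<s)) = leg-decreasing 1 j t (λ _ → z<s)

leg-grow : ∀ i j → (if j ≡ᵇ i then suc (leg j i) else leg j i) ≡ leg (suc j) i
leg-grow zero    zero    = refl
leg-grow zero    (suc j) = refl
leg-grow (suc i) zero    = refl
leg-grow (suc i) (suc j) = leg-grow i j

module Hook (k t : ℕ) where

  μ : List ℕ
  μ = k ∷ k ∷ replicate t 1

  open Chamber (suc (suc t))

  state : ℕ → ℕ → ℕ → (ℕ → ℕ)
  state a b j 0             = a
  state a b j 1             = b
  state a b j (suc (suc i)) = leg j i

  state-valid : ∀ a b j → b ≤ a → (0 < j → 0 < b) → valid (state a b j) ≡ true
  state-valid a b j b≤a j>0⇒b>0 rewrite T⇒≡true (≤⇒≤ᵇ b≤a) = leg-decreasing b j t j>0⇒b>0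

  hits-state : ∀ d b j → j ≤ t → hits μ (state (d + b) b j) ≡ 𝟙 ((b ≡ᵇ k) ∧ ((d ≡ᵇ 0) ∧ (j ≡ᵇ t)))
  hits-state d b j j≤t rewrite leg-eqList j t j≤t with b ≡ᵇ k | proof (b ≟ k)
  ... | true  | ofʸ refl rewrite +-≡ᵇ-cancelʳ d b = refl
  ... | false | ofⁿ _    = cong 𝟙 (∧-zeroʳ (d + b ≡ᵇ k))

  doubled-leg-cell : ∀ m a b j s → s < j → j ≤ t → walks (hits μ) (state a b j ⊕ suc (suc s)) m ≡ 0
  doubled-leg-cell m a b j s s<j j≤t = walks-vanish (hits μ) _ m miss
    where
    two : (state a b j ⊕ suc (suc s)) (suc (suc s)) ≡ 2
    two rewrite ≡ᵇ-refl s | T⇒≡true (<⇒<ᵇ s<j) = refl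
    miss : ∀ ν' → (∀ i → (state a b j ⊕ suc (suc s)) i ≤ ν' i) → hits μ ν' ≡ 0
    miss ν' ≤ν' with eqList (shape ν') μ in e
    ... | false = refl
    ... | true  = ⊥-elim (<⇒≱ (subst (2 ≤_) one (subst (_≤ ν' (suc (suc s))) two (≤ν' (suc (suc s))))) ≤-refl)
      where one = replicate-entry (ν' ∘ suc ∘ suc) t (∧-trueʳ {ν' 1 ≡ᵇ k} (∧-trueʳ {ν' 0 ≡ᵇ k} e))
                                  s (<-≤-trans s<j j≤t)

  detached-leg-cell : ∀ m a b j s → j < s → s < t → walks (hits μ) (state a b j ⊕ suc (suc s)) m ≡ 0
  detached-leg-cell m a b j (suc s) (s≤s j≤s) s<t =
    walks-increasing-row (hits μ) _ m (suc (suc s)) (s<s (s<s s<t)) increase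
    where
    increase : (state a b j ⊕ suc (suc (suc s))) (suc (suc s)) < (state a b j ⊕ suc (suc (suc s))) (suc (suc (suc s)))
    increase rewrite ≢⇒≡ᵇ-false (1+n≢n {s}) | ≤⇒<ᵇ-false j≤s | ≡ᵇ-refl s = z<s

  walks≡hookWalks : ∀ m d b j → j ≤ t → (0 < j → 0 < b) →
                    walks (hits μ) (state (d + b) b j) m ≡ hookWalks k t d b j m
  walks≡hookWalks zero d b j j≤t j>0⇒b>0
    rewrite state-valid (d + b) b j (m≤n+m b d) j>0⇒b>0 = hits-state d b j j≤t
  walks≡hookWalks (suc m) d b j j≤t j>0⇒b>0
    rewrite state-valid (d + b) b j (m≤n+m b d) j>0⇒b>0 = cong₂ _+_ up (cong₂ _+_ (down d) flat)
    where
    ν = state (d + b) b j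
    ext : ∀ {ν ν'} → ν ≗ ν' → walks (hits μ) ν m ≡ walks (hits μ) ν' m
    ext = walks-ext (hits μ) (hits-cong μ) m
    up : walks (hits μ) (ν ⊕ 0) m ≡ hookWalks k t (suc d) b j m
    up = trans (ext (λ { 0 → refl ; 1 → refl ; (suc (suc _)) → refl })) (walks≡hookWalks m (suc d) b j j≤t j>0⇒b>0)
    down : ∀ d → walks (hits μ) (state (d + b) b j ⊕ 1) m ≡ lower (λ d' → hookWalks k t d' (suc b) j m) d
    down zero     = walks-increasing-row (hits μ) _ m 0 (s<s z<s) (n<1+n b)
    down (suc d') = trans (ext (λ { 0 → sym (+-suc d' b) ; 1 → refl ; (suc (suc _)) → refl }))
                          (walks≡hookWalks m d' (suc b) j j≤t (λ _ → z<s))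
    extend-leg : ∀ b → j < t →
      walks (hits μ) (state (d + b) b j ⊕ suc (suc j)) m ≡ (if 0 <ᵇ b then hookWalks k t d b (suc j) m else 0)
    extend-leg zero    j<t =
      walks-increasing-row (hits μ) _ m 1 (s<s (s<s (≤-trans z<s j<t))) (subst (0 <_) (sym (leg-grow 0 j)) z<s)
    extend-leg (suc b) j<t = trans (ext (λ { 0 → refl ; 1 → refl ; (suc (suc i)) → leg-grow i j }))
                                   (walks≡hookWalks m d (suc b) (suc j) j<t (λ _ → z<s))
    flat : ∑[ s < t ] walks (hits μ) (ν ⊕ suc (suc s)) m ≡ (if 0 <ᵇ b then hookWalks k t d b (suc j) m else 0)
    flat with m≤n⇒m<n∨m≡n j≤t
    ... | inj₁ j<t = trans (∑-select t j j<t other) (extend-leg b j<t)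
      where
      other : ∀ s → s < t → s ≢ j → walks (hits μ) (ν ⊕ suc (suc s)) m ≡ 0
      other s s<t s≢j with <-cmp s j
      ... | tri< s<j _ _ = doubled-leg-cell m (d + b) b j s s<j j≤t
      ... | tri≈ _ s≡j _ = ⊥-elim (s≢j s≡j)
      ... | tri> _ _ j<s = detached-leg-cell m (d + b) b j s j<s s<t
    ... | inj₂ j≡t =
      trans (∑-zero t (λ s s<t → doubled-leg-cell m (d + b) b j s (subst (s <_) (sym j≡t) s<t) j≤t))
            (sym (if-0 (0 <ᵇ b) (hookWalks-overfull k t m d b (suc j) (s≤s (≤-reflexive (sym j≡t))))))

f≡hookWalks : ∀ n k → k + k ≤ n → f (hook2 n k) ≡ hookWalks k (n ∸ (k + k)) 0 0 0 n
f≡hookWalks n k k+k≤n = begin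
  f μ
    ≡⟨ f≡walks μ ⟩
  Chamber.walks (length μ) (Chamber.hits (length μ) μ) (λ _ → 0) (sum μ)
    ≡⟨ cong₂ (λ ℓ m → Chamber.walks ℓ (Chamber.hits ℓ μ) (λ _ → 0) m)
             (cong (suc ∘ suc) (length-replicate t)) size≡n ⟩
  Chamber.walks (suc (suc t)) (Chamber.hits (suc (suc t)) μ) (λ _ → 0) n
    ≡⟨ Chamber.walks-ext (suc (suc t)) _ (Chamber.hits-cong (suc (suc t)) μ) n
                         (λ { 0 → refl ; 1 → refl ; (suc (suc _)) → refl }) ⟩
  Chamber.walks (suc (suc t)) (Chamber.hits (suc (suc t)) μ) (Hook.state k t 0 0 0) n
    ≡⟨ Hook.walks≡hookWalks k t n 0 0 0 z≤n (λ ()) ⟩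
  hookWalks k t 0 0 0 n ∎
  where
  open ≡-Reasoning
  t = n ∸ (k + k)
  μ = Hook.μ k t
  size≡n : k + (k + sum (replicate t 1)) ≡ n
  size≡n = trans (sym (+-assoc k k _)) (trans (cong (k + k +_) (sum-replicate-1 t)) (m+[n∸m]≡n k+k≤n))

hookSum : ℕ → ℕ → ℕ → ℕ
hookSum d zero    m = riordan d m
hookSum d (suc _) m = motzkin d m

hookSum-step : ∀ d b m → hookSum d b (suc m) ≡
  hookSum (suc d) b m + (lower (λ d' → hookSum d' (suc b) m) d + (if 0 <ᵇ b then hookSum d b m else 0))
hookSum-step d zero    m = cong (riordan (suc d) m +_) (sym (+-identityʳ _))
hookSum-step d (suc b) m = refl

hookTotal : ℕ → ℕ → ℕ → ℕ → ℕ → ℕ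
hookTotal n d b j m = ∑[ i < n / 2 ] hookWalks (suc i) (n ∸ (suc i + suc i)) d b j m

∑-lower : ∀ N (F : ℕ → ℕ → ℕ) d → ∑[ i < N ] lower (F i) d ≡ lower (λ d' → ∑[ i < N ] F i d') d
∑-lower N F zero    = ∑-zero N (λ _ _ → refl)
∑-lower N F (suc d) = refl

hookTotal-step : ∀ n d b j m → hookTotal n d b j (suc m) ≡
  hookTotal n (suc d) b j m + (lower (λ d' → hookTotal n d' (suc b) j m) d
  + (if 0 <ᵇ b then hookTotal n d b (suc j) m else 0))
hookTotal-step n d b j m =
  trans (∑-+ (n / 2) up (λ i → down i + flat i))
        (cong (hookTotal n (suc d) b j m +_)
              (trans (∑-+ (n / 2) down flat)
                     (cong₂ _+_ (∑-lower (n / 2) (λ i d' → H i d' (suc b) j) d)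
                                (∑-if (n / 2) (0 <ᵇ b) (λ i → H i d b (suc j))))))
  where
  H : ℕ → ℕ → ℕ → ℕ → ℕ
  H i d b j = hookWalks (suc i) (n ∸ (suc i + suc i)) d b j m
  up down flat : ℕ → ℕ
  up i   = H i (suc d) b j
  down i = lower (λ d' → H i d' (suc b) j) d
  flat i = if 0 <ᵇ b then H i d b (suc j) else 0

k+k≡k*2 : ∀ k → k + k ≡ k * 2
k+k≡k*2 = solve-∀

k+k≤n⇒k≤n/2 : ∀ k n → k + k ≤ n → k ≤ n / 2
k+k≤n⇒k≤n/2 k n k+k≤n = subst (_≤ n / 2) (m*n/n≡m k 2) (/-monoˡ-≤ 2 (subst (_≤ n) (k+k≡k*2 k) k+k≤n))

k≤n/2⇒k+k≤n : ∀ k n → k ≤ n / 2 → k + k ≤ n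
k≤n/2⇒k+k≤n k n k≤n/2 = subst (_≤ n) (sym (k+k≡k*2 k)) (≤-trans (*-mono-≤ k≤n/2 (≤-refl {2})) (m/n*n≤m n 2))

hookTotal≡hookSum : ∀ n m d b j → d + b + b + j + m ≡ n → hookTotal n d b j m ≡ hookSum d b m
hookTotal≡hookSum n zero d zero j _ = ∑-zero (n / 2) (λ _ _ → refl)
hookTotal≡hookSum n zero d (suc b) j size =
  trans (∑-select (n / 2) b (k+k≤n⇒k≤n/2 (suc b) n 2b≤n) other) (diagonal d size)
  where
  2b≤n : suc b + suc b ≤ n
  2b≤n = subst (suc b + suc b ≤_) (trans (regroup d b j) size) (m≤m+n (suc b + suc b) (d + j))
    where regroup : ∀ d b j → suc b + suc b + (d + j) ≡ d + suc b + suc b + j + 0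
          regroup = solve-∀
  other : ∀ i → i < n / 2 → i ≢ b → hookWalks (suc i) (n ∸ (suc i + suc i)) d (suc b) j 0 ≡ 0
  other i _ i≢b =
    cong (λ x → 𝟙 (x ∧ ((d ≡ᵇ 0) ∧ (j ≡ᵇ n ∸ (suc i + suc i))))) (≢⇒≡ᵇ-false (i≢b ∘ sym))
  diagonal : ∀ d → d + suc b + suc b + j + 0 ≡ n → hookWalks (suc b) (n ∸ (suc b + suc b)) d (suc b) j 0 ≡ motzkin d 0
  diagonal zero    s rewrite ≡ᵇ-refl b = cong 𝟙 (T⇒≡true (≡⇒≡ᵇ j _ j≡t))
    where
    j≡t : j ≡ n ∸ (suc b + suc b)
    j≡t = trans (sym (m+n∸m≡n (suc b + suc b) j)) (cong (_∸ (suc b + suc b)) (trans (sym (+-identityʳ _)) s))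
  diagonal (suc d) _ rewrite ≡ᵇ-refl b = refl
hookTotal≡hookSum n (suc m) d b j size =
  trans (hookTotal-step n d b j m)
 (trans (cong₂ _+_ (hookTotal≡hookSum n m (suc d) b j (trans (up d b j m) size))
                   (cong₂ _+_ (down d size) (flat b size)))
        (sym (hookSum-step d b m)))
  where
  up : ∀ d b j m → suc d + b + b + j + m ≡ d + b + b + j + suc m
  up = solve-∀
  down : ∀ d → d + b + b + j + suc m ≡ n →
         lower (λ d' → hookTotal n d' (suc b) j m) d ≡ lower (λ d' → hookSum d' (suc b) m) d
  down zero     _ = refl
  down (suc d') s = hookTotal≡hookSum n m d' (suc b) j (trans (shift d' b j m) s)
    where shift : ∀ d b j m → d + suc b + suc b + j + m ≡ suc d + b + b + j + suc m
          shift = solve-∀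
  flat : ∀ b → d + b + b + j + suc m ≡ n →
         (if 0 <ᵇ b then hookTotal n d b (suc j) m else 0) ≡ (if 0 <ᵇ b then hookSum d b m else 0)
  flat zero    _ = refl
  flat (suc b) s = hookTotal≡hookSum n m d (suc b) (suc j) (trans (grow d (suc b) j m) s)
    where grow : ∀ d b j m → d + b + b + suc j + m ≡ d + b + b + j + suc m
          grow = solve-∀

sumY≡riordan : ∀ n → sumY n ≡ riordan 0 n
sumY≡riordan n =
  trans (sum-map-upTo (λ i → f (hook2 n (suc i))) (n / 2))
 (trans (∑-cong (n / 2) (λ i i<n/2 → f≡hookWalks n (suc i) (k≤n/2⇒k+k≤n (suc i) n i<n/2)))
        (hookTotal≡hookSum n n 0 0 0 refl))

≡-from-pair-sums : ∀ (u v : ℕ → ℕ) → u 1 ≡ v 1 →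
  (∀ m → u (2 + m) + u (1 + m) ≡ v (2 + m) + v (1 + m)) → ∀ m → u (1 + m) ≡ v (1 + m)
≡-from-pair-sums u v base step zero    = base
≡-from-pair-sums u v base step (suc m) =
  +-cancelʳ-≡ _ (u (2 + m)) (v (2 + m)) (trans (step m) (cong (v (2 + m) +_) (sym (≡-from-pair-sums u v base step m))))

theorem4p5 : (n : ℕ) → 1 ≤ n → sumX n ≡ sumY n
theorem4p5 (suc m) _ = begin
  sumX (suc m)                 ≡⟨ sumX≡evenWalks (suc m) ⟩
  evenWalks (λ _ → 0) (suc m)  ≡⟨ ≡-from-pair-sums (evenWalks (λ _ → 0)) (riordan 0) refl same-pair-sums m ⟩
  riordan 0 (suc m)            ≡⟨ sumY≡riordan (suc m) ⟨
  sumY (suc m)                 ∎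
  where
  open ≡-Reasoning
  same-pair-sums : ∀ m →
    evenWalks (λ _ → 0) (2 + m) + evenWalks (λ _ → 0) (1 + m) ≡ riordan 0 (2 + m) + riordan 0 (1 + m)
  same-pair-sums m = begin
    evenWalks (λ _ → 0) (2 + m) + evenWalks (λ _ → 0) (1 + m) ≡⟨ evenWalks-pair-sum (λ _ → 0) (1 + m) ⟩
    chamberWalks (λ _ → 0) (1 + m)                            ≡⟨ chamberWalks≡motzkin (1 + m) ⟩
    motzkin 0 (1 + m)                                         ≡⟨ +-identityʳ _ ⟨
    motzkin 0 (1 + m) + 0                                     ≡⟨ riordan-pair-sum m 0 ⟨
    riordan 0 (2 + m) + riordan 0 (1 + m)                     ∎
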